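{- Let $p$ and $q$ be nonzero integers with $p - q \neq 1$. Let $(U_n)_{n\ge0}$ be defined by $U_0=0$, $U_1=1$, and $U_n = pU_{n-1}-qU_{n-2}$ for $n\ge2$. Then for all $n \geq 1$, $$\sum_{i=1}^n i\, U_i = \frac{1}{p-q-1} \left( n(U_{n+1} - q U_n) - \frac{\Omega(n)}{p-q-1} \right),$$ where $\Omega(n) = U_{n+1} - 2q U_n + q^2 U_{n-1} + q - 1$.
   Context: $(U_n)$ is the Lucas sequence of the first kind with parameters $p,q$. -}

module Defs where

open import Data.Nat as ℕ using (ℕ; zero; suc)
open import Data.Integer as ℤ using (ℤ; +_)
open import Data.Rational as ℚ using (ℚ; 0ℚ; 1ℚ; _÷_; ≢-nonZero)
open import Data.Rational.Properties using (↥-/)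
open import Data.Integer.Properties using (i-j≡0⇒i≡j)
open import Data.Integer.GCD using (gcd)
open import Relation.Binary.PropositionalEquality using (_≡_; _≢_; cong; trans; sym)

U : ℤ → ℤ → ℕ → ℤ
U p q zero = + 0
U p q (suc zero) = + 1
U p q (suc (suc n)) = p ℤ.* U p q (suc n) ℤ.- q ℤ.* U p q n

sumIU : ℤ → ℤ → ℕ → ℤ
sumIU p q zero = + 0
sumIU p q (suc n) = sumIU p q n ℤ.+ (+ suc n) ℤ.* U p q (suc n)

-- Ω(n) = U_{n+1} - 2 q U_n + q^2 U_{n-1} + q - 1, for n ≥ 1 (given as n = suc m)
Ω : ℤ → ℤ → ℕ → ℤ
Ω p q m = U p q (suc (suc m)) ℤ.- (+ 2) ℤ.* q ℤ.* U p q (suc m)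
          ℤ.+ q ℤ.* q ℤ.* U p q m ℤ.+ q ℤ.- (+ 1)

dQ : ℤ → ℤ → ℚ
dQ p q = ℚ._/_ (p ℤ.- q ℤ.- + 1) 1

dQ≢0 : (p q : ℤ) → p ℤ.- q ≢ + 1 → dQ p q ≢ 0ℚ
dQ≢0 p q h e = h (i-j≡0⇒i≡j (p ℤ.- q) (+ 1)
  (trans (sym (↥-/ (p ℤ.- q ℤ.- + 1) 1)) (cong (λ r → ℚ.↥ r ℤ.* gcd (p ℤ.- q ℤ.- + 1) (+ 1)) e)))

rhs : (p q : ℤ) → p ℤ.- q ≢ + 1 → ℕ → ℚ
rhs p q h m =
  (ℚ._/_ ((+ suc m) ℤ.* (U p q (suc (suc m)) ℤ.- q ℤ.* U p q (suc m))) 1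
    ℚ.- (_÷_ (ℚ._/_ (Ω p q m) 1) (dQ p q) {{≢-nonZero (dQ≢0 p q h)}}))
  ÷ dQ p q
  where instance _ = ≢-nonZero (dQ≢0 p q h)

-- Multiplying through by (p - q - 1)² turns the claim into the integer identity
--   (p - q - 1)² ∑ᵢ₌₁ⁿ i Uᵢ = (p - q - 1) n (Uₙ₊₁ - q Uₙ) - Ω(n).
-- It holds at n = 1, and once Uₙ₊₂ and Uₙ₊₁ are expanded by the recurrence, the right-hand
-- side grows from n to n + 1 by exactly (p - q - 1)² (n + 1) Uₙ₊₁, the new term of the sum:
-- a polynomial identity in p, q, n, Uₙ₋₁ and Uₙ.
module Submission where

open import Defs
open import Data.Nat using (ℕ; zero; suc)
open import Data.Integer as ℤ using (ℤ; +_; -_; _+_; _-_; _*_)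
open import Data.Integer.Properties using (*-distribˡ-+)
open import Data.Integer.Tactic.RingSolver using (solve-∀)
open import Data.Rational as ℚ using (1ℚ; NonZero; _/_; _÷_; 1/_; fromℚᵘ; ≢-nonZero)
open import Data.Rational.Properties
  using (toℚᵘ-injective; toℚᵘ-fromℚᵘ; fromℚᵘ-cong; toℚᵘ-homo-+; toℚᵘ-homo-*; toℚᵘ-homo‿-; *-inverseʳ)
open import Data.Rational.Solver using (module +-*-Solver)
open import Data.Rational.Unnormalised as ℚᵘ using (mkℚᵘ; *≡*)
open import Data.Rational.Unnormalised.Properties using (≃-trans; ≃-sym; +-cong; *-cong; -‿cong)
open import Relation.Binary.PropositionalEquality using (_≡_; _≢_; refl; sym; trans; cong; module ≡-Reasoning)

fromℚᵘ-homo-+ : ∀ x y → fromℚᵘ (x ℚᵘ.+ y) ≡ fromℚᵘ x ℚ.+ fromℚᵘ y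
fromℚᵘ-homo-+ x y = toℚᵘ-injective (≃-trans (toℚᵘ-fromℚᵘ (x ℚᵘ.+ y))
  (≃-sym (≃-trans (toℚᵘ-homo-+ (fromℚᵘ x) (fromℚᵘ y)) (+-cong (toℚᵘ-fromℚᵘ x) (toℚᵘ-fromℚᵘ y)))))

fromℚᵘ-homo-* : ∀ x y → fromℚᵘ (x ℚᵘ.* y) ≡ fromℚᵘ x ℚ.* fromℚᵘ y
fromℚᵘ-homo-* x y = toℚᵘ-injective (≃-trans (toℚᵘ-fromℚᵘ (x ℚᵘ.* y))
  (≃-sym (≃-trans (toℚᵘ-homo-* (fromℚᵘ x) (fromℚᵘ y)) (*-cong (toℚᵘ-fromℚᵘ x) (toℚᵘ-fromℚᵘ y)))))

fromℚᵘ-homo‿- : ∀ x → fromℚᵘ (ℚᵘ.- x) ≡ ℚ.- fromℚᵘ x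
fromℚᵘ-homo‿- x = toℚᵘ-injective (≃-trans (toℚᵘ-fromℚᵘ (ℚᵘ.- x))
  (≃-sym (≃-trans (toℚᵘ-homo‿- (fromℚᵘ x)) (-‿cong (toℚᵘ-fromℚᵘ x)))))

-- i / 1 is fromℚᵘ (mkℚᵘ i 0) by definition, so the embedding ℤ → ℚ inherits these.
/1-homo-+ : ∀ i j → (i + j) / 1 ≡ i / 1 ℚ.+ j / 1
/1-homo-+ i j = trans (fromℚᵘ-cong {mkℚᵘ (i + j) 0} {mkℚᵘ i 0 ℚᵘ.+ mkℚᵘ j 0} (*≡* (sum≃ i j)))
                      (fromℚᵘ-homo-+ (mkℚᵘ i 0) (mkℚᵘ j 0))
  where
  sum≃ : ∀ i j → (i + j) * + 1 ≡ (i * + 1 + j * + 1) * + 1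
  sum≃ = solve-∀

/1-homo-* : ∀ i j → (i * j) / 1 ≡ (i / 1) ℚ.* (j / 1)
/1-homo-* i j = fromℚᵘ-homo-* (mkℚᵘ i 0) (mkℚᵘ j 0)

/1-homo‿- : ∀ i → (- i) / 1 ≡ ℚ.- (i / 1)
/1-homo‿- i = fromℚᵘ-homo‿- (mkℚᵘ i 0)

/1-homo-− : ∀ i j → (i - j) / 1 ≡ i / 1 ℚ.- j / 1
/1-homo-− i j = trans (/1-homo-+ i (- j)) (cong (i / 1 ℚ.+_) (/1-homo‿- j))

d*d*s≡d*a-o⇒s≡[a-o÷d]÷d : ∀ {d s a o} .{{_ : NonZero d}} →
  d ℚ.* d ℚ.* s ≡ d ℚ.* a ℚ.- o → s ≡ (a ℚ.- o ÷ d) ÷ d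
d*d*s≡d*a-o⇒s≡[a-o÷d]÷d {d} {s} {a} {o} eq = begin
  s                                         ≡⟨ solve 1 (λ s → s := s :* con 1ℚ :* con 1ℚ) refl s ⟩
  s ℚ.* 1ℚ ℚ.* 1ℚ                           ≡⟨ cong (λ x → s ℚ.* x ℚ.* x) (sym d*e≡1) ⟩
  s ℚ.* (d ℚ.* e) ℚ.* (d ℚ.* e)             ≡⟨ solve 3 (λ s d e → s :* (d :* e) :* (d :* e) := d :* d :* s :* e :* e) refl s d e ⟩
  d ℚ.* d ℚ.* s ℚ.* e ℚ.* e                 ≡⟨ cong (λ x → x ℚ.* e ℚ.* e) eq ⟩
  (d ℚ.* a ℚ.- o) ℚ.* e ℚ.* e               ≡⟨ solve 4 (λ d e a o → (d :* a :- o) :* e :* e := d :* e :* a :* e :- o :* e :* e) refl d e a o ⟩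
  d ℚ.* e ℚ.* a ℚ.* e ℚ.- o ℚ.* e ℚ.* e     ≡⟨ cong (λ x → x ℚ.* a ℚ.* e ℚ.- o ℚ.* e ℚ.* e) d*e≡1 ⟩
  1ℚ ℚ.* a ℚ.* e ℚ.- o ℚ.* e ℚ.* e          ≡⟨ solve 3 (λ e a o → con 1ℚ :* a :* e :- o :* e :* e := (a :- o :* e) :* e) refl e a o ⟩
  (a ℚ.- o ℚ.* e) ℚ.* e                     ∎
  where
  open ≡-Reasoning
  open +-*-Solver
  e = 1/ d
  d*e≡1 : d ℚ.* e ≡ 1ℚ
  d*e≡1 = *-inverseʳ d

δ : ℤ → ℤ → ℤ
δ p q = p - q - + 1

closedForm : ℤ → ℤ → ℕ → ℤ
closedForm p q m = δ p q * (+ suc m * (U p q (suc (suc m)) - q * U p q (suc m))) - Ω p q m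

-- The ring solver does not unfold U, sumIU and Ω, so the identities below are stated on
-- their unfolded forms, with the sequence values as variables.
closedForm-one : ∀ p q → closedForm p q 0 ≡ δ p q * δ p q * sumIU p q 1
closedForm-one p q = unfolded p q
  where
  unfolded : ∀ p q → let d = p - q - + 1 in
    d * (+ 1 * (p * + 1 - q * + 0 - q * + 1)) - (p * + 1 - q * + 0 - + 2 * q * + 1 + q * q * + 0 + q - + 1)
      ≡ d * d * (+ 0 + + 1 * + 1)
  unfolded = solve-∀

closedForm-suc : ∀ p q m →
  closedForm p q (suc m) ≡ closedForm p q m + δ p q * δ p q * (+ suc (suc m) * U p q (suc (suc m)))
closedForm-suc p q m = lucasStep p q (+ m) (U p q m) (U p q (suc m))
  where
  lucasStep : ∀ p q n u₀ u₁ →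
    let d = p - q - + 1
        u₂ = p * u₁ - q * u₀
        u₃ = p * u₂ - q * u₁
    in d * ((+ 1 + (+ 1 + n)) * (u₃ - q * u₂)) - (u₃ - + 2 * q * u₂ + q * q * u₁ + q - + 1)
       ≡ d * ((+ 1 + n) * (u₂ - q * u₁)) - (u₂ - + 2 * q * u₁ + q * q * u₀ + q - + 1)
         + d * d * ((+ 1 + (+ 1 + n)) * u₂)
  lucasStep = solve-∀

δ²*sumIU≡closedForm : ∀ p q m → δ p q * δ p q * sumIU p q (suc m) ≡ closedForm p q m
δ²*sumIU≡closedForm p q zero = sym (closedForm-one p q)
δ²*sumIU≡closedForm p q (suc m) = begin
  d² * (sumIU p q (suc m) + t)        ≡⟨ *-distribˡ-+ d² (sumIU p q (suc m)) t ⟩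
  d² * sumIU p q (suc m) + d² * t     ≡⟨ cong (_+ d² * t) (δ²*sumIU≡closedForm p q m) ⟩
  closedForm p q m + d² * t           ≡⟨ closedForm-suc p q m ⟨
  closedForm p q (suc m)              ∎
  where
  open ≡-Reasoning
  d² = δ p q * δ p q
  t = + suc (suc m) * U p q (suc (suc m))

theorem4p7 : (p q : ℤ) → p ≢ + 0 → q ≢ + 0 → (h : p - q ≢ + 1) →
    (m : ℕ) → sumIU p q (suc m) / 1 ≡ rhs p q h m
theorem4p7 p q _ _ h m = d*d*s≡d*a-o⇒s≡[a-o÷d]÷d {d / 1} {{≢-nonZero (dQ≢0 p q h)}} (begin
  (d / 1) ℚ.* (d / 1) ℚ.* (s / 1)        ≡⟨ cong (ℚ._* (s / 1)) (/1-homo-* d d) ⟨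
  ((d * d) / 1) ℚ.* (s / 1)              ≡⟨ /1-homo-* (d * d) s ⟨
  (d * d * s) / 1                        ≡⟨ cong (_/ 1) (δ²*sumIU≡closedForm p q m) ⟩
  (d * a - Ω p q m) / 1                  ≡⟨ /1-homo-− (d * a) (Ω p q m) ⟩
  (d * a) / 1 ℚ.- Ω p q m / 1            ≡⟨ cong (ℚ._- Ω p q m / 1) (/1-homo-* d a) ⟩
  (d / 1) ℚ.* (a / 1) ℚ.- Ω p q m / 1    ∎)
  where
  open ≡-Reasoning
  d = δ p q
  s = sumIU p q (suc m)
  a = + suc m * (U p q (suc (suc m)) - q * U p q (suc m))
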